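{- Let $\alpha<\beta<\gamma$ be distinct primes, let $G=\langle a\rangle$ be a cyclic group of order $\alpha^2\beta^2\gamma^2$, and let $C=\{x\in G : |x|\in\{\alpha^2,\beta^2,\gamma^2\}\}$. Let $Cay_{p^2}(G,C)$ be the simple undirected graph with vertex set $G$ in which two distinct vertices $x,y$ are adjacent if and only if $xy^{ -1}\in C$. Then every independent set $S$ of $Cay_{p^2}(G,C)$ satisfies $|S|\le\alpha^2\beta^2\gamma$.
   Context: $|x|$ denotes the order of the element $x$ in $G$. An independent set is a set of pairwise non-adjacent vertices. -}

module Defs where

open import Data.Nat using (ℕ; _+_; _*_; _∸_; _≤_; _^_)
open import Data.Nat.Divisibility using (_∣_)
open import Data.Fin using (Fin; toℕ)
open import Data.Fin.Subset using (Subset; _∈_)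
open import Data.Product using (_×_; ∃)
open import Data.Sum using (_⊎_)
open import Relation.Binary.PropositionalEquality using (_≡_)
open import Relation.Nullary using (¬_)

-- The cyclic group G = ⟨a⟩ of order n is modelled as the additive group
-- ℤ/nℤ with carrier Fin n (a ↦ 1, a^i ↦ i).  Group multiplication is
-- addition mod n and x y⁻¹ is x - y mod n.

-- A natural-number representative of the residue class x - y (mod n).
-- (x - y mod n is the residue of this number modulo n.)
diffRep : (n : ℕ) → Fin n → Fin n → ℕ
diffRep n x y = toℕ x + (n ∸ toℕ y)

-- |g| = k in ℤ/nℤ, where g is given by any representative d :
-- k is the least positive integer with k·g = 0, i.e. n ∣ k * d.
-- (This only depends on the residue class of d modulo n.)
HasOrder : (n d k : ℕ) → Set
HasOrder n d k =
  1 ≤ k × n ∣ k * d × (∀ j → 1 ≤ j → n ∣ j * d → k ≤ j)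

InC : (α β γ n d : ℕ) → Set
InC α β γ n d = HasOrder n d (α ^ 2) ⊎ HasOrder n d (β ^ 2) ⊎ HasOrder n d (γ ^ 2)

Adj : (α β γ n : ℕ) → Fin n → Fin n → Set
Adj α β γ n x y = ¬ (x ≡ y) × InC α β γ n (diffRep n x y)

Independent : (α β γ n : ℕ) → Subset n → Set
Independent α β γ n S = ∀ x y → x ∈ S → y ∈ S → ¬ Adj α β γ n x y

-- Put M = α²β² and write a vertex as x = r + M (b + γ a) with r < M and a, b < γ.
-- Two distinct vertices with the same key (r, a) differ by ±cM with 0 < c < γ, and
-- since c is prime to γ the element cM of ℤ/Mγ² has order exactly γ², so the two
-- vertices are adjacent. An independent set therefore injects into the Mγ keys.

module Submission where

open import Data.Nat
  using (ℕ; zero; suc; _+_; _*_; _∸_; _^_; _≤_; _<_; z≤n; s≤s; NonZero; >-nonZero; >-nonZero⁻¹; ≢-nonZero)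
open import Data.Nat.Properties
open import Data.Nat.DivMod
open import Data.Nat.Divisibility
open import Data.Nat.Coprimality using (Coprime; coprime-divisor; prime⇒coprime)
open import Data.Nat.Primality using (Prime; prime⇒nonZero)
open import Data.Fin as Fin using (Fin; toℕ; combine; fromℕ<)
import Data.Fin.Properties as Fin
open import Data.Fin.Subset using (Subset; _∈_; ∣_∣; inside; outside; _-_)
open import Data.Fin.Subset.Properties using (x∈p⇒∣p-x∣<∣p∣; x∈p∧x≢y⇒x∈p-y; ∈⊤; ∣⊤∣≡n)
open import Data.Vec.Base using (_∷_; []; here; there)
open import Data.Product using (_×_; _,_; proj₁; proj₂)
open import Data.Sum using (inj₁; inj₂)
open import Data.Empty using (⊥-elim)
open import Function using (_∘_; case_of_; _⇔_; mk⇔; Equivalence)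
open import Relation.Binary.PropositionalEquality
open import Relation.Nullary using (¬_; yes; no)

open import Defs

InjectiveOn : ∀ {m} {B : Set} → Subset m → (Fin m → B) → Set
InjectiveOn p f = ∀ {i j} → i ∈ p → j ∈ p → f i ≡ f j → i ≡ j

injectiveOn⇒∣p∣≤∣q∣ : ∀ {m n} {p : Subset m} {q : Subset n} (f : Fin m → Fin n) →
  (∀ {i} → i ∈ p → f i ∈ q) → InjectiveOn p f → ∣ p ∣ ≤ ∣ q ∣
injectiveOn⇒∣p∣≤∣q∣ {p = []} f mapsTo injective = z≤n
injectiveOn⇒∣p∣≤∣q∣ {p = outside ∷ p} f mapsTo injective =
  injectiveOn⇒∣p∣≤∣q∣ (f ∘ Fin.suc) (mapsTo ∘ there)
    (λ i∈p j∈p → Fin.suc-injective ∘ injective (there i∈p) (there j∈p))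
injectiveOn⇒∣p∣≤∣q∣ {p = inside ∷ p} {q} f mapsTo injective =
  ≤-trans (s≤s (injectiveOn⇒∣p∣≤∣q∣ (f ∘ Fin.suc) mapsTo-q-f₀
                  (λ i∈p j∈p → Fin.suc-injective ∘ injective (there i∈p) (there j∈p))))
          (x∈p⇒∣p-x∣<∣p∣ (mapsTo here))
  where
  mapsTo-q-f₀ : ∀ {i} → i ∈ p → f (Fin.suc i) ∈ q - f Fin.zero
  mapsTo-q-f₀ i∈p = x∈p∧x≢y⇒x∈p-y (mapsTo (there i∈p))
    (λ fi≡f₀ → case injective (there i∈p) here fi≡f₀ of λ ())

injectiveOn⇒∣p∣≤n : ∀ {m n} {p : Subset m} (f : Fin m → Fin n) → InjectiveOn p f → ∣ p ∣ ≤ n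
injectiveOn⇒∣p∣≤n {n = n} f injective =
  subst (_ ≤_) (∣⊤∣≡n n) (injectiveOn⇒∣p∣≤∣q∣ f (λ _ → ∈⊤) injective)

coprime-divisor-^ : ∀ {a c j} .{{_ : NonZero a}} → Coprime a c → ∀ k → a ^ k ∣ c * j → a ^ k ∣ j
coprime-divisor-^ cop zero    _ = 1∣ _
coprime-divisor-^ {a} {c} {j} cop (suc k) aᵏ⁺¹∣cj
  with divides q refl ← coprime-divisor cop (m*n∣⇒m∣ a (a ^ k) aᵏ⁺¹∣cj) =
  subst (a * a ^ k ∣_) (*-comm a q) (*-monoʳ-∣ a aᵏ∣q)
  where
  aᵏ∣q : a ^ k ∣ q
  aᵏ∣q = coprime-divisor-^ cop k (*-cancelˡ-∣ a (subst (a * a ^ k ∣_) (c*[q*a]≡a*[c*q]) aᵏ⁺¹∣cj))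
    where
    c*[q*a]≡a*[c*q] : c * (q * a) ≡ a * (c * q)
    c*[q*a]≡a*[c*q] = trans (sym (*-assoc c q a)) (*-comm (c * q) a)

annihilators≡multiples⇒hasOrder : ∀ {n d k} .{{_ : NonZero k}} →
  (∀ j → (n ∣ j * d) ⇔ (k ∣ j)) → HasOrder n d k
annihilators≡multiples⇒hasOrder {k = k} annihilates =
  >-nonZero⁻¹ k , Equivalence.from (annihilates k) ∣-refl ,
  λ j 1≤j n∣jd → ∣⇒≤ {{>-nonZero 1≤j}} (Equivalence.to (annihilates j) n∣jd)

hasOrder-n+ : ∀ {n d k} → HasOrder n d k → HasOrder n (n + d) k
hasOrder-n+ {n} {d} {k} (1≤k , n∣kd , least) =
  1≤k , reduce⁻¹ k n∣kd , λ j 1≤j n∣j[n+d] → least j 1≤j (reduce j n∣j[n+d])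
  where
  reduce : ∀ j → n ∣ j * (n + d) → n ∣ j * d
  reduce j h = ∣m+n∣m⇒∣n (subst (n ∣_) (*-distribˡ-+ j n d) h) (n∣m*n j)

  reduce⁻¹ : ∀ j → n ∣ j * d → n ∣ j * (n + d)
  reduce⁻¹ j h = subst (n ∣_) (sym (*-distribˡ-+ j n d)) (∣m∣n⇒∣m+n (n∣m*n j) h)

hasOrder-c*M : ∀ {M a c} .{{_ : NonZero M}} .{{_ : NonZero a}} → Coprime a c → ∀ k →
  HasOrder (M * a ^ k) (c * M) (a ^ k)
hasOrder-c*M {M} {a} {c} cop k = annihilators≡multiples⇒hasOrder {{m^n≢0 a k}} λ j →
  mk⇔ (coprime-divisor-^ cop k ∘ *-cancelˡ-∣ M ∘ subst (M * a ^ k ∣_) (j*[c*M]≡M*[c*j] j))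
      (subst (M * a ^ k ∣_) (sym (j*[c*M]≡M*[c*j] j)) ∘ *-monoʳ-∣ M ∘ ∣n⇒∣m*n c)
  where
  j*[c*M]≡M*[c*j] : ∀ j → j * (c * M) ≡ M * (c * j)
  j*[c*M]≡M*[c*j] j = trans (*-comm j (c * M)) (trans (cong (_* j) (*-comm c M)) (*-assoc M c j))

m%k≡n%k⇒n≡m+[n/k∸m/k]*k : ∀ {m n} k .{{_ : NonZero k}} → m ≤ n → m % k ≡ n % k →
  n ≡ m + (n / k ∸ m / k) * k
m%k≡n%k⇒n≡m+[n/k∸m/k]*k {m} {n} k m≤n m%k≡n%k = begin
  n                            ≡⟨ m≡m%n+[m/n]*n n k ⟩
  n % k + n / k * k            ≡⟨ cong₂ (λ r q → r + q * k) (sym m%k≡n%k) (sym (m+[n∸m]≡n (/-monoˡ-≤ k m≤n))) ⟩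
  m % k + (m / k + c) * k      ≡⟨ cong (m % k +_) (*-distribʳ-+ k (m / k) c) ⟩
  m % k + (m / k * k + c * k)  ≡⟨ +-assoc (m % k) (m / k * k) (c * k) ⟨
  m % k + m / k * k + c * k    ≡⟨ cong (_+ c * k) (m≡m%n+[m/n]*n m k) ⟨
  m + c * k                    ∎
  where
  open ≡-Reasoning
  c : ℕ
  c = n / k ∸ m / k

m/k≡n/k⇒n∸m<k : ∀ m n k .{{_ : NonZero k}} → m / k ≡ n / k → n ∸ m < k
m/k≡n/k⇒n∸m<k m n k m/k≡n/k = begin-strict
  n ∸ m          ≤⟨ ∸-monoʳ-≤ n (m/n*n≤m m k) ⟩
  n ∸ m / k * k  ≡⟨ cong (λ q → n ∸ q * k) m/k≡n/k ⟩
  n ∸ n / k * k  ≡⟨ m%n≡m∸m/n*n n k ⟨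
  n % k          <⟨ m%n<n n k ⟩
  k              ∎
  where open ≤-Reasoning

m<o*n^2⇒m/o/n<n : ∀ {m n o} .{{_ : NonZero n}} .{{_ : NonZero o}} → m < o * n ^ 2 → m / o / n < n
m<o*n^2⇒m/o/n<n {m} {n} {o} m<o*n² =
  m<n*o⇒m/o<n (m<n*o⇒m/o<n (subst (m <_) o*n^2≡n*n*o m<o*n²))
  where
  o*n^2≡n*n*o : o * n ^ 2 ≡ n * n * o
  o*n^2≡n*n*o = trans (*-comm o (n ^ 2)) (cong (λ k → n * k * o) (*-identityʳ n))

diffRep-≡ : ∀ {n} {x y : Fin n} e → toℕ x ≡ toℕ y + e → diffRep n x y ≡ n + e
diffRep-≡ {n} {x} {y} e x≡y+e = begin
  toℕ x + (n ∸ toℕ y)        ≡⟨ cong (_+ (n ∸ toℕ y)) x≡y+e ⟩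
  toℕ y + e + (n ∸ toℕ y)    ≡⟨ +-assoc (toℕ y) e (n ∸ toℕ y) ⟩
  toℕ y + (e + (n ∸ toℕ y))  ≡⟨ cong (toℕ y +_) (+-comm e (n ∸ toℕ y)) ⟩
  toℕ y + ((n ∸ toℕ y) + e)  ≡⟨ +-assoc (toℕ y) (n ∸ toℕ y) e ⟨
  toℕ y + (n ∸ toℕ y) + e    ≡⟨ cong (_+ e) (m+[n∸m]≡n (Fin.toℕ≤n y)) ⟩
  n + e                      ∎
  where open ≡-Reasoning

module _ {M p : ℕ} .{{_ : NonZero M}} (p-prime : Prime p) where

  private instance
    p≢0 : NonZero p
    p≢0 = prime⇒nonZero p-prime

  remainder : Fin (M * p ^ 2) → Fin M
  remainder x = fromℕ< (m%n<n (toℕ x) M)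

  block : Fin (M * p ^ 2) → Fin p
  block x = fromℕ< (m<o*n^2⇒m/o/n<n (Fin.toℕ<n x))

  blockKey : Fin (M * p ^ 2) → Fin (M * p)
  blockKey x = combine (remainder x) (block x)

  sameBlockKey⇒hasOrder-p^2 : ∀ {x y} → toℕ y ≤ toℕ x → x ≢ y → blockKey x ≡ blockKey y →
    HasOrder (M * p ^ 2) (diffRep (M * p ^ 2) x y) (p ^ 2)
  sameBlockKey⇒hasOrder-p^2 {x} {y} y≤x x≢y key≡ =
    subst (λ d → HasOrder (M * p ^ 2) d (p ^ 2)) (sym (diffRep-≡ (c * M) x≡y+c*M))
      (hasOrder-n+ (hasOrder-c*M (prime⇒coprime p-prime {{c≢0}} c<p) 2))
    where
    key-components≡ : remainder x ≡ remainder y × block x ≡ block y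
    key-components≡ = Fin.combine-injective (remainder x) (block x) (remainder y) (block y) key≡

    c : ℕ
    c = toℕ x / M ∸ toℕ y / M

    x≡y+c*M : toℕ x ≡ toℕ y + c * M
    x≡y+c*M = m%k≡n%k⇒n≡m+[n/k∸m/k]*k M y≤x
      (sym (Fin.fromℕ<-injective (toℕ x % M) (toℕ y % M) _ _ (proj₁ key-components≡)))

    c<p : c < p
    c<p = m/k≡n/k⇒n∸m<k (toℕ y / M) (toℕ x / M) p
      (sym (Fin.fromℕ<-injective (toℕ x / M / p) (toℕ y / M / p) _ _ (proj₂ key-components≡)))

    c≢0 : NonZero c
    c≢0 = ≢-nonZero λ c≡0 → x≢y (Fin.toℕ-injective (begin
      toℕ x          ≡⟨ x≡y+c*M ⟩
      toℕ y + c * M  ≡⟨ cong (λ c → toℕ y + c * M) c≡0 ⟩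
      toℕ y + 0      ≡⟨ +-identityʳ (toℕ y) ⟩
      toℕ y          ∎))
      where open ≡-Reasoning

  ∣S∣≤M*p : (S : Subset (M * p ^ 2)) →
    (∀ {x y} → x ∈ S → y ∈ S → x ≢ y → ¬ HasOrder (M * p ^ 2) (diffRep (M * p ^ 2) x y) (p ^ 2)) →
    ∣ S ∣ ≤ M * p
  ∣S∣≤M*p S noOrder-p^2 = injectiveOn⇒∣p∣≤n blockKey injective
    where
    injective : InjectiveOn S blockKey
    injective {x} {y} x∈S y∈S key≡ with x Fin.≟ y | ≤-total (toℕ y) (toℕ x)
    ... | yes x≡y | _   = x≡y
    ... | no x≢y | inj₁ y≤x =
      ⊥-elim (noOrder-p^2 x∈S y∈S x≢y (sameBlockKey⇒hasOrder-p^2 y≤x x≢y key≡))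
    ... | no x≢y | inj₂ x≤y =
      ⊥-elim (noOrder-p^2 y∈S x∈S (x≢y ∘ sym) (sameBlockKey⇒hasOrder-p^2 x≤y (x≢y ∘ sym) (sym key≡)))

proposition2p14 : (α β γ : ℕ) → Prime α → Prime β → Prime γ → α < β → β < γ →
    (S : Subset (α ^ 2 * β ^ 2 * γ ^ 2)) →
    Independent α β γ (α ^ 2 * β ^ 2 * γ ^ 2) S →
    ∣ S ∣ ≤ α ^ 2 * β ^ 2 * γ
proposition2p14 α β γ α-prime β-prime γ-prime _ _ S independent =
  ∣S∣≤M*p {{α²β²≢0}} γ-prime S λ x∈S y∈S x≢y hasOrder-γ² →
    independent _ _ x∈S y∈S (x≢y , inj₂ (inj₂ hasOrder-γ²))
  where
  α²β²≢0 : NonZero (α ^ 2 * β ^ 2)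
  α²β²≢0 = m*n≢0 (α ^ 2) (β ^ 2)
    {{m^n≢0 α 2 {{prime⇒nonZero α-prime}}}} {{m^n≢0 β 2 {{prime⇒nonZero β-prime}}}}
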